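{- Fix a positive integer $k$ and define $(a_k(n))_{n\ge0}$ by $a_k(0)=1$ and $a_k(n+1) = \sum_{0\le i\le n,\ k\mid i} a_k(i)\,a_k(n-i)$ for $n\ge0$. Then for every $r\in\{0,1,\dots,k-1\}$ and every $m\ge1$, \[ a_k(km)=\sum_{j=0}^{m-1} a_k(kj+r)\,a_k(k(m-j)-r-1). \] -}

module Defs where

open import Data.Nat using (ℕ; zero; suc; _+_; _*_; _∸_; _≤?_)
open import Data.Nat.Divisibility using (_∣?_)
open import Data.List using (List; map; upTo)
open import Data.Nat.ListAction using (sum)
open import Relation.Nullary.Decidable using (does)
open import Data.Bool using (if_then_else_)

Σ< : ℕ → (ℕ → ℕ) → ℕ
Σ< n f = sum (map f (upTo n))

nextTerm : ℕ → ℕ → (ℕ → ℕ) → ℕ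
nextTerm k n f = Σ< (suc n) (λ i → if does (k ∣? i) then f i * f (n ∸ i) else 0)

-- table k n j = a_k(j) for all j ≤ n  (memoised course-of-values recursion)
table : ℕ → ℕ → ℕ → ℕ
table k zero    j = 1
table k (suc n) j = if does (j ≤? n) then table k n j else nextTerm k n (table k n)

a : ℕ → ℕ → ℕ
a k n = table k n n

{-# OPTIONS --safe #-}
-- Write A = a_k, and for a residue r let A_r be A restricted to the indices
-- ≡ r (mod k); A_0 = B is A restricted to the multiples of k.  The recurrence
-- says A(n+1) = (B ⋆ A)(n), where ⋆ is the Cauchy convolution, and since B
-- lives on multiples of k this restricts to classes: A_{r+1} = X·(B ⋆ A_r)
-- for r + 1 < k, and A(n+1) = (B ⋆ A_{n mod k})(n).  Commutativity and
-- associativity of ⋆ then let the factor X·B move between the two factors: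
-- A_{r+1} ⋆ A_s = A_r ⋆ A_{s+1}.  Hence A_r ⋆ A_s = B ⋆ A_{k-1} whenever
-- r + s = k - 1, and evaluating at km - 1 gives both sides of the identity.
module Submission where

open import Defs
open import Algebra.Properties.CommutativeSemigroup using (interchange)
open import Data.Bool using (true; false; if_then_else_)
open import Data.Bool.Properties using (if-float)
open import Data.List using (map; applyUpTo)
open import Data.Sum using (inj₁; inj₂)
open import Data.Nat using (ℕ; zero; suc; _+_; _*_; _∸_; _<_; _≤_; _≤?_; _≟_; _%_; _/_; NonZero; >-nonZero⁻¹; z<s; s<s; s≤s; s≤s⁻¹)
open import Data.Nat.DivMod
  using (m≡m%n+[m/n]*n; [m+kn]%n≡m%n; m*n≤o⇒[o∸m*n]%n≡o%n; m<n⇒m%n≡m; %-remove-+ˡ;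
         m<[1+n%d]⇒m≤[n%d]; [1+m%d]≤1+n⇒[m%d]≤n)
open import Data.Nat.Divisibility using (_∣?_; divides; m∣m*n; m%n≡0⇒n∣m; n∣m⇒m%n≡0)
open import Data.Nat.ListAction using (sum)
open import Data.Nat.Properties
open import Function using (id; _∘_; _⇔_; mk⇔)
open import Relation.Nullary using (Dec; yes; no; ¬_; does)
open import Relation.Nullary.Decidable using (dec-true; dec-false; does-⇔)
open import Relation.Binary.PropositionalEquality
  using (_≡_; _≢_; _≗_; refl; sym; trans; cong; cong₂; subst; module ≡-Reasoning)

open ≡-Reasoning

+-interchange : ∀ w x y z → (w + x) + (y + z) ≡ (w + y) + (x + z)
+-interchange = interchange +-commutativeSemigroup

if-true : ∀ {P : Set} (p? : Dec P) {x y : ℕ} → P → (if does p? then x else y) ≡ x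
if-true p? p = cong (if_then _ else _) (dec-true p? p)

if-false : ∀ {P : Set} (p? : Dec P) {x y : ℕ} → ¬ P → (if does p? then x else y) ≡ y
if-false p? ¬p = cong (if_then _ else _) (dec-false p? ¬p)

*-if-zero : ∀ c b {x : ℕ} → c * (if b then x else 0) ≡ (if b then c * x else 0)
*-if-zero c true  = refl
*-if-zero c false = *-zeroʳ c

∑ : ℕ → (ℕ → ℕ) → ℕ
∑ zero    f = 0
∑ (suc n) f = f 0 + ∑ n (f ∘ suc)

sum-map-applyUpTo : ∀ n (g f : ℕ → ℕ) → sum (map f (applyUpTo g n)) ≡ ∑ n (f ∘ g)
sum-map-applyUpTo zero    g f = refl
sum-map-applyUpTo (suc n) g f = cong (f (g 0) +_) (sum-map-applyUpTo n (g ∘ suc) f)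

Σ<≡∑ : ∀ n f → Σ< n f ≡ ∑ n f
Σ<≡∑ n f = sum-map-applyUpTo n id f

∑-cong : ∀ n {f g : ℕ → ℕ} → (∀ i → i < n → f i ≡ g i) → ∑ n f ≡ ∑ n g
∑-cong zero    f≡g = refl
∑-cong (suc n) f≡g = cong₂ _+_ (f≡g 0 z<s) (∑-cong n (λ i i<n → f≡g (suc i) (s<s i<n)))

∑-zero : ∀ n → ∑ n (λ _ → 0) ≡ 0
∑-zero zero    = refl
∑-zero (suc n) = ∑-zero n

∑-distrib-+ : ∀ n (f g : ℕ → ℕ) → ∑ n (λ i → f i + g i) ≡ ∑ n f + ∑ n g
∑-distrib-+ zero    f g = refl
∑-distrib-+ (suc n) f g =
  trans (cong (f 0 + g 0 +_) (∑-distrib-+ n (f ∘ suc) (g ∘ suc))) (+-interchange (f 0) (g 0) _ _)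

*-distribˡ-∑ : ∀ n c (f : ℕ → ℕ) → ∑ n (λ i → c * f i) ≡ c * ∑ n f
*-distribˡ-∑ zero    c f = sym (*-zeroʳ c)
*-distribˡ-∑ (suc n) c f =
  trans (cong (c * f 0 +_) (*-distribˡ-∑ n c (f ∘ suc))) (sym (*-distribˡ-+ c (f 0) _))

∑-sucʳ : ∀ n (f : ℕ → ℕ) → ∑ (suc n) f ≡ ∑ n f + f n
∑-sucʳ zero    f = +-comm (f 0) 0
∑-sucʳ (suc n) f = trans (cong (f 0 +_) (∑-sucʳ n (f ∘ suc))) (sym (+-assoc (f 0) _ _))

∑-split : ∀ m n (f : ℕ → ℕ) → ∑ (m + n) f ≡ ∑ m f + ∑ n (λ i → f (m + i))
∑-split zero    n f = refl
∑-split (suc m) n f = trans (cong (f 0 +_) (∑-split m n (f ∘ suc))) (sym (+-assoc (f 0) _ _))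

∑-single : ∀ n r (f : ℕ → ℕ) → r < n → (∀ i → i < n → i ≢ r → f i ≡ 0) → ∑ n f ≡ f r
∑-single (suc n) zero f _ f≡0 = begin
  f 0 + ∑ n (f ∘ suc)    ≡⟨ cong (f 0 +_) (∑-cong n (λ i i<n → f≡0 (suc i) (s<s i<n) λ ())) ⟩
  f 0 + ∑ n (λ _ → 0)    ≡⟨ cong (f 0 +_) (∑-zero n) ⟩
  f 0 + 0                ≡⟨ +-identityʳ (f 0) ⟩
  f 0                    ∎
∑-single (suc n) (suc r) f (s<s r<n) f≡0 =
  trans (cong (_+ ∑ n (f ∘ suc)) (f≡0 0 z<s λ ()))
        (∑-single n r (f ∘ suc) r<n (λ i i<n i≢r → f≡0 (suc i) (s<s i<n) (i≢r ∘ suc-injective)))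

∑-if : ∀ n b (f : ℕ → ℕ) → ∑ n (λ i → if b then f i else 0) ≡ (if b then ∑ n f else 0)
∑-if n true  f = refl
∑-if n false f = ∑-zero n

infixl 7 _⋆_

_⋆_ : (ℕ → ℕ) → (ℕ → ℕ) → ℕ → ℕ
(f ⋆ g) n = ∑ (suc n) (λ i → f i * g (n ∸ i))

-- Multiplication of the generating function by X.
shift : (ℕ → ℕ) → ℕ → ℕ
shift f zero    = 0
shift f (suc n) = f n

⋆-congˡ : ∀ {f f′} g → f ≗ f′ → f ⋆ g ≗ f′ ⋆ g
⋆-congˡ g f≗f′ n = ∑-cong (suc n) (λ i _ → cong (_* g (n ∸ i)) (f≗f′ i))

⋆-congʳ : ∀ f {g g′} → g ≗ g′ → f ⋆ g ≗ f ⋆ g′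
⋆-congʳ f g≗g′ n = ∑-cong (suc n) (λ i _ → cong (f i *_) (g≗g′ (n ∸ i)))

⋆-sucʳ : ∀ f g n → (f ⋆ g) (suc n) ≡ (f ⋆ (g ∘ suc)) n + f (suc n) * g 0
⋆-sucʳ f g n = begin
  (f ⋆ g) (suc n)
    ≡⟨ ∑-sucʳ (suc n) (λ i → f i * g (suc n ∸ i)) ⟩
  ∑ (suc n) (λ i → f i * g (suc n ∸ i)) + f (suc n) * g (suc n ∸ suc n)
    ≡⟨ cong₂ _+_ (∑-cong (suc n) λ i i≤n → cong (λ t → f i * g t) (+-∸-assoc 1 (s≤s⁻¹ i≤n)))
                 (cong (λ t → f (suc n) * g t) (n∸n≡0 n)) ⟩
  (f ⋆ (g ∘ suc)) n + f (suc n) * g 0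
    ∎

⋆-comm : ∀ f g → f ⋆ g ≗ g ⋆ f
⋆-comm f g zero    = cong (_+ 0) (*-comm (f 0) (g 0))
⋆-comm f g (suc n) = begin
  f 0 * g (suc n) + ((f ∘ suc) ⋆ g) n   ≡⟨ cong (f 0 * g (suc n) +_) (⋆-comm (f ∘ suc) g n) ⟩
  f 0 * g (suc n) + (g ⋆ (f ∘ suc)) n   ≡⟨ +-comm (f 0 * g (suc n)) _ ⟩
  (g ⋆ (f ∘ suc)) n + f 0 * g (suc n)   ≡⟨ cong ((g ⋆ (f ∘ suc)) n +_) (*-comm (f 0) (g (suc n))) ⟩
  (g ⋆ (f ∘ suc)) n + g (suc n) * f 0   ≡⟨ ⋆-sucʳ g f n ⟨
  (g ⋆ f) (suc n)                       ∎

⋆-distribʳ-+ : ∀ f g h → (λ i → f i + g i) ⋆ h ≗ λ n → (f ⋆ h) n + (g ⋆ h) n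
⋆-distribʳ-+ f g h n =
  trans (∑-cong (suc n) (λ i _ → *-distribʳ-+ (h (n ∸ i)) (f i) (g i)))
        (∑-distrib-+ (suc n) (λ i → f i * h (n ∸ i)) (λ i → g i * h (n ∸ i)))

*-distribˡ-⋆ : ∀ c f g → (λ i → c * f i) ⋆ g ≗ λ n → c * (f ⋆ g) n
*-distribˡ-⋆ c f g n =
  trans (∑-cong (suc n) (λ i _ → *-assoc c (f i) (g (n ∸ i))))
        (*-distribˡ-∑ (suc n) c (λ i → f i * g (n ∸ i)))

⋆-unfoldˡ : ∀ f g → f ⋆ g ≗ λ n → f 0 * g n + shift ((f ∘ suc) ⋆ g) n
⋆-unfoldˡ f g zero    = refl
⋆-unfoldˡ f g (suc n) = refl

-- Induction on the first factor, peeled as f = f 0 + X · (f ∘ suc).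
⋆-assoc : ∀ f g h → (f ⋆ g) ⋆ h ≗ f ⋆ (g ⋆ h)
⋆-assoc f g h n = begin
  ((f ⋆ g) ⋆ h) n
    ≡⟨ ⋆-congˡ h (⋆-unfoldˡ f g) n ⟩
  ((λ i → f 0 * g i + shift ((f ∘ suc) ⋆ g) i) ⋆ h) n
    ≡⟨ ⋆-distribʳ-+ (λ i → f 0 * g i) (shift ((f ∘ suc) ⋆ g)) h n ⟩
  ((λ i → f 0 * g i) ⋆ h) n + (shift ((f ∘ suc) ⋆ g) ⋆ h) n
    ≡⟨ cong (_+ (shift ((f ∘ suc) ⋆ g) ⋆ h) n) (*-distribˡ-⋆ (f 0) g h n) ⟩
  f 0 * (g ⋆ h) n + (shift ((f ∘ suc) ⋆ g) ⋆ h) n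
    ≡⟨ shifted n ⟩
  (f ⋆ (g ⋆ h)) n
    ∎
  where
  shifted : ∀ n → f 0 * (g ⋆ h) n + (shift ((f ∘ suc) ⋆ g) ⋆ h) n ≡ (f ⋆ (g ⋆ h)) n
  shifted zero    = refl
  shifted (suc n) = cong (f 0 * (g ⋆ h) (suc n) +_) (⋆-assoc (f ∘ suc) g h n)

⋆-balance : ∀ k (G : ℕ → ℕ → ℕ) h → (∀ r → suc r < k → G (suc r) ≗ h ⋆ G r) →
            ∀ r s → r + s < k → G r ⋆ G s ≗ G 0 ⋆ G (r + s)
⋆-balance k G h G-step zero    s _        n = refl
⋆-balance k G h G-step (suc r) s r+s<k n = begin
  (G (suc r) ⋆ G s) n          ≡⟨ ⋆-congˡ (G s) (G-step r (≤-<-trans (s≤s (m≤m+n r s)) r+s<k)) n ⟩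
  ((h ⋆ G r) ⋆ G s) n          ≡⟨ ⋆-congˡ (G s) (⋆-comm h (G r)) n ⟩
  ((G r ⋆ h) ⋆ G s) n          ≡⟨ ⋆-assoc (G r) h (G s) n ⟩
  (G r ⋆ (h ⋆ G s)) n          ≡⟨ ⋆-congʳ (G r) (G-step s (≤-<-trans (s≤s (m≤n+m s r)) r+s<k)) n ⟨
  (G r ⋆ G (suc s)) n          ≡⟨ ⋆-balance k G h G-step r (suc s) (subst (_< k) (sym (+-suc r s)) r+s<k) n ⟩
  (G 0 ⋆ G (r + suc s)) n      ≡⟨ cong (λ t → (G 0 ⋆ G t) n) (+-suc r s) ⟩
  (G 0 ⋆ G (suc r + s)) n      ∎

table-correct : ∀ k n j → j ≤ n → table k n j ≡ a k j
table-correct k zero    zero    _     = refl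
table-correct k (suc n) j       j≤1+n with m≤n⇒m<n∨m≡n j≤1+n
... | inj₁ j<1+n = trans (if-true (j ≤? n) (s≤s⁻¹ j<1+n)) (table-correct k n j (s≤s⁻¹ j<1+n))
... | inj₂ refl  = refl

a-recurrence : ∀ k n → a k (suc n) ≡ ∑ (suc n) (λ i → if does (k ∣? i) then a k i * a k (n ∸ i) else 0)
a-recurrence k n = begin
  a k (suc n)                   ≡⟨ if-false (suc n ≤? n) (n≮n n) ⟩
  nextTerm k n (table k n)      ≡⟨ Σ<≡∑ (suc n) _ ⟩
  ∑ (suc n) (λ i → if does (k ∣? i) then table k n i * table k n (n ∸ i) else 0)
    ≡⟨ ∑-cong (suc n) (λ i i≤n → cong (if does (k ∣? i) then_else 0)
         (cong₂ _*_ (table-correct k n i (s≤s⁻¹ i≤n)) (table-correct k n (n ∸ i) (m∸n≤m n i)))) ⟩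
  ∑ (suc n) (λ i → if does (k ∣? i) then a k i * a k (n ∸ i) else 0) ∎

k*m∸1∸[k*j+r]≡k*[m∸j]∸r∸1 : ∀ k m j r → k * m ∸ 1 ∸ (k * j + r) ≡ k * (m ∸ j) ∸ r ∸ 1
k*m∸1∸[k*j+r]≡k*[m∸j]∸r∸1 k m j r = begin
  k * m ∸ 1 ∸ (k * j + r)        ≡⟨ ∸-+-assoc (k * m) 1 (k * j + r) ⟩
  k * m ∸ (1 + (k * j + r))      ≡⟨ cong (k * m ∸_) (trans (+-comm 1 (k * j + r)) (+-assoc (k * j) r 1)) ⟩
  k * m ∸ (k * j + (r + 1))      ≡⟨ ∸-+-assoc (k * m) (k * j) (r + 1) ⟨
  k * m ∸ k * j ∸ (r + 1)        ≡⟨ cong (_∸ (r + 1)) (*-distribˡ-∸ k m j) ⟨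
  k * (m ∸ j) ∸ (r + 1)          ≡⟨ ∸-+-assoc (k * (m ∸ j)) r 1 ⟨
  k * (m ∸ j) ∸ r ∸ 1            ∎

k*[1+t]∸r∸1≡k*t+[k∸[1+r]] : ∀ k t {r} → r < k → k * suc t ∸ r ∸ 1 ≡ k * t + (k ∸ suc r)
k*[1+t]∸r∸1≡k*t+[k∸[1+r]] k t {r} r<k = begin
  k * suc t ∸ r ∸ 1              ≡⟨ ∸-+-assoc (k * suc t) r 1 ⟩
  k * suc t ∸ (r + 1)            ≡⟨ cong₂ _∸_ (*-suc k t) (+-comm r 1) ⟩
  (k + k * t) ∸ suc r            ≡⟨ +-∸-comm (k * t) r<k ⟩
  (k ∸ suc r) + k * t            ≡⟨ +-comm (k ∸ suc r) (k * t) ⟩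
  k * t + (k ∸ suc r)            ∎

module Residues (k : ℕ) .{{_ : NonZero k}} where

  classPart : ℕ → (ℕ → ℕ) → ℕ → ℕ
  classPart r f n = if does (n % k ≟ r) then f n else 0

  [k*q+t]%k≡t : ∀ q {t} → t < k → (k * q + t) % k ≡ t
  [k*q+t]%k≡t q {t} t<k = trans (%-remove-+ˡ t (m∣m*n q)) (m<n⇒m%n≡m t<k)

  [n∸i]%k≡n%k : ∀ {i} n → i % k ≡ 0 → i ≤ n → (n ∸ i) % k ≡ n % k
  [n∸i]%k≡n%k {i} n i%k≡0 i≤n with m%n≡0⇒n∣m i k i%k≡0
  ... | divides q refl = m*n≤o⇒[o∸m*n]%n≡o%n q i≤n

  [1+n]%k≡1+r⇔n%k≡r : ∀ n {r} → suc r < k → (suc n % k ≡ suc r) ⇔ (n % k ≡ r)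
  [1+n]%k≡1+r⇔n%k≡r n {r} 1+r<k = mk⇔ to from
    where
    to : suc n % k ≡ suc r → n % k ≡ r
    to eq = ≤-antisym
      ([1+m%d]≤1+n⇒[m%d]≤n n r k (subst (0 <_) (sym eq) z<s) (≤-reflexive eq))
      (m<[1+n%d]⇒m≤[n%d] n k (≤-reflexive (sym eq)))
    from : n % k ≡ r → suc n % k ≡ suc r
    from eq = begin
      suc n % k                           ≡⟨ cong (λ t → suc t % k) (m≡m%n+[m/n]*n n k) ⟩
      (suc (n % k) + (n / k) * k) % k     ≡⟨ [m+kn]%n≡m%n (suc (n % k)) (n / k) k ⟩
      suc (n % k) % k                     ≡⟨ cong (λ t → suc t % k) eq ⟩
      suc r % k                           ≡⟨ m<n⇒m%n≡m 1+r<k ⟩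
      suc r                               ∎

  classPart-≡ : ∀ {r} f {n} → n % k ≡ r → classPart r f n ≡ f n
  classPart-≡ f {n} = if-true (n % k ≟ _)

  classPart-≢ : ∀ {r} f {n} → n % k ≢ r → classPart r f n ≡ 0
  classPart-≢ f {n} = if-false (n % k ≟ _)

  -- Since the first factor lives on multiples of k, every index n ∸ i met by
  -- the convolution is in the class of n.
  classPart-zero-⋆ : ∀ f g r → classPart 0 f ⋆ classPart r g ≗ classPart r (classPart 0 f ⋆ g)
  classPart-zero-⋆ f g r n =
    trans (∑-cong (suc n) (λ i i≤n → trans (term i i≤n) (*-if-zero (classPart 0 f i) (does (n % k ≟ r)))))
          (∑-if (suc n) (does (n % k ≟ r)) (λ i → classPart 0 f i * g (n ∸ i)))
    where
    term : ∀ i → i < suc n →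
           classPart 0 f i * classPart r g (n ∸ i) ≡ classPart 0 f i * (if does (n % k ≟ r) then g (n ∸ i) else 0)
    term i i≤n with i % k ≟ 0
    ... | yes i%k≡0 = cong (λ t → classPart 0 f i * (if does (t ≟ r) then g (n ∸ i) else 0))
                           ([n∸i]%k≡n%k n i%k≡0 (s≤s⁻¹ i≤n))
    ... | no  i%k≢0 = trans (cong (_* _) (classPart-≢ f i%k≢0)) (sym (cong (_* _) (classPart-≢ f i%k≢0)))

  ∑-classPart : ∀ m {r} → r < k → (g : ℕ → ℕ) → ∑ (k * m) (classPart r g) ≡ ∑ m (λ j → g (k * j + r))
  ∑-classPart zero {r} r<k g = cong (λ t → ∑ t (classPart r g)) (*-zeroʳ k)
  ∑-classPart (suc m) {r} r<k g = begin
    ∑ (k * suc m) (classPart r g)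
      ≡⟨ cong (λ t → ∑ t (classPart r g)) (trans (*-suc k m) (+-comm k (k * m))) ⟩
    ∑ (k * m + k) (classPart r g)
      ≡⟨ ∑-split (k * m) k (classPart r g) ⟩
    ∑ (k * m) (classPart r g) + ∑ k (λ i → classPart r g (k * m + i))
      ≡⟨ cong₂ _+_ (∑-classPart m r<k g) (∑-single k r _ r<k λ i i<k i≢r →
           classPart-≢ g (λ eq → i≢r (trans (sym ([k*q+t]%k≡t m i<k)) eq))) ⟩
    ∑ m (λ j → g (k * j + r)) + classPart r g (k * m + r)
      ≡⟨ cong (∑ m (λ j → g (k * j + r)) +_) (classPart-≡ g ([k*q+t]%k≡t m r<k)) ⟩
    ∑ m (λ j → g (k * j + r)) + g (k * m + r)
      ≡⟨ ∑-sucʳ m (λ j → g (k * j + r)) ⟨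
    ∑ (suc m) (λ j → g (k * j + r))
      ∎

  classPart⋆classPart[k*m∸1] : ∀ f g m .{{_ : NonZero m}} {r} → r < k →
    (classPart r f ⋆ classPart (k ∸ suc r) g) (k * m ∸ 1) ≡ ∑ m (λ j → f (k * j + r) * g (k * (m ∸ j) ∸ r ∸ 1))
  classPart⋆classPart[k*m∸1] f g m {r} r<k = begin
    ∑ (suc N) (λ i → classPart r f i * h i)
      ≡⟨ cong (λ t → ∑ t (λ i → classPart r f i * h i)) (suc-pred (k * m) {{m*n≢0 k m}}) ⟩
    ∑ (k * m) (λ i → classPart r f i * h i)
      ≡⟨ ∑-cong (k * m) (λ i _ → if-float (_* h i) (does (i % k ≟ r))) ⟩
    ∑ (k * m) (classPart r (λ i → f i * h i))
      ≡⟨ ∑-classPart m r<k (λ i → f i * h i) ⟩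
    ∑ m (λ j → f (k * j + r) * h (k * j + r))
      ≡⟨ ∑-cong m (λ j j<m → cong (f (k * j + r) *_) (h[k*j+r] j j<m)) ⟩
    ∑ m (λ j → f (k * j + r) * g (k * (m ∸ j) ∸ r ∸ 1))
      ∎
    where
    N : ℕ
    N = k * m ∸ 1
    h : ℕ → ℕ
    h i = classPart (k ∸ suc r) g (N ∸ i)
    h[k*j+r] : ∀ j → j < m → h (k * j + r) ≡ g (k * (m ∸ j) ∸ r ∸ 1)
    h[k*j+r] j j<m = begin
      h (k * j + r)                               ≡⟨ cong (classPart (k ∸ suc r) g) (k*m∸1∸[k*j+r]≡k*[m∸j]∸r∸1 k m j r) ⟩
      classPart (k ∸ suc r) g (k * (m ∸ j) ∸ r ∸ 1) ≡⟨ classPart-≡ g residue ⟩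
      g (k * (m ∸ j) ∸ r ∸ 1)                     ∎
      where
      residue : (k * (m ∸ j) ∸ r ∸ 1) % k ≡ k ∸ suc r
      residue = begin
        (k * (m ∸ j) ∸ r ∸ 1) % k             ≡⟨ cong (λ t → (k * t ∸ r ∸ 1) % k) (+-∸-assoc 1 {m} j<m) ⟩
        (k * suc (m ∸ suc j) ∸ r ∸ 1) % k     ≡⟨ cong (_% k) (k*[1+t]∸r∸1≡k*t+[k∸[1+r]] k (m ∸ suc j) r<k) ⟩
        (k * (m ∸ suc j) + (k ∸ suc r)) % k   ≡⟨ [k*q+t]%k≡t (m ∸ suc j) (∸-monoʳ-< z<s r<k) ⟩
        k ∸ suc r                             ∎

  a-suc≡classPart-zero-⋆ : ∀ n → a k (suc n) ≡ (classPart 0 (a k) ⋆ a k) n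
  a-suc≡classPart-zero-⋆ n = trans (a-recurrence k n) (∑-cong (suc n) λ i _ → begin
    (if does (k ∣? i) then a k i * a k (n ∸ i) else 0)
      ≡⟨ cong (if_then a k i * a k (n ∸ i) else 0)
              (does-⇔ (mk⇔ (n∣m⇒m%n≡0 i k) (m%n≡0⇒n∣m i k)) (k ∣? i) (i % k ≟ 0)) ⟩
    (if does (i % k ≟ 0) then a k i * a k (n ∸ i) else 0)
      ≡⟨ if-float (_* a k (n ∸ i)) (does (i % k ≟ 0)) ⟨
    classPart 0 (a k) i * a k (n ∸ i)
      ∎)

  a-suc≡classPart-zero-⋆-classPart : ∀ n → a k (suc n) ≡ (classPart 0 (a k) ⋆ classPart (n % k) (a k)) n
  a-suc≡classPart-zero-⋆-classPart n = begin
    a k (suc n)                                       ≡⟨ a-suc≡classPart-zero-⋆ n ⟩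
    (classPart 0 (a k) ⋆ a k) n                       ≡⟨ classPart-≡ (classPart 0 (a k) ⋆ a k) refl ⟨
    classPart (n % k) (classPart 0 (a k) ⋆ a k) n     ≡⟨ classPart-zero-⋆ (a k) (a k) (n % k) n ⟨
    (classPart 0 (a k) ⋆ classPart (n % k) (a k)) n   ∎

  classPart-suc≡shift-⋆ : ∀ r → suc r < k → classPart (suc r) (a k) ≗ shift (classPart 0 (a k)) ⋆ classPart r (a k)
  classPart-suc≡shift-⋆ r 1+r<k zero    =
    classPart-≢ (a k) λ 0%k≡1+r → 0≢1+n (trans (sym (m<n⇒m%n≡m (>-nonZero⁻¹ k))) 0%k≡1+r)
  classPart-suc≡shift-⋆ r 1+r<k (suc n) = begin
    classPart (suc r) (a k) (suc n)
      ≡⟨ cong (if_then a k (suc n) else 0) (does-⇔ ([1+n]%k≡1+r⇔n%k≡r n 1+r<k) (suc n % k ≟ suc r) (n % k ≟ r)) ⟩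
    (if does (n % k ≟ r) then a k (suc n) else 0)
      ≡⟨ cong (if does (n % k ≟ r) then_else 0) (a-suc≡classPart-zero-⋆ n) ⟩
    classPart r (classPart 0 (a k) ⋆ a k) n
      ≡⟨ classPart-zero-⋆ (a k) (a k) r n ⟨
    (classPart 0 (a k) ⋆ classPart r (a k)) n
      ∎

mainTheorem4 : (k : ℕ) → 1 ≤ k → (r : ℕ) → r < k → (m : ℕ) → 1 ≤ m →
    a k (k * m) ≡ Σ< m (λ j → a k (k * j + r) * a k (k * (m ∸ j) ∸ r ∸ 1))
mainTheorem4 (suc k′) _ r r<k (suc m′) _ = begin
  a k (suc N)                                   ≡⟨ a-suc≡classPart-zero-⋆-classPart N ⟩
  (classPart 0 A ⋆ classPart (N % k) A) N       ≡⟨ cong (λ t → (classPart 0 A ⋆ classPart t A) N) N%k≡r+s ⟩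
  (classPart 0 A ⋆ classPart (r + s) A) N       ≡⟨ ⋆-balance k (λ t → classPart t A) (shift (classPart 0 A))
                                                     classPart-suc≡shift-⋆ r s r+s<k N ⟨
  (classPart r A ⋆ classPart s A) N             ≡⟨ classPart⋆classPart[k*m∸1] A A (suc m′) r<k ⟩
  ∑ (suc m′) (λ j → A (k * j + r) * A (k * (suc m′ ∸ j) ∸ r ∸ 1))
                                                ≡⟨ Σ<≡∑ (suc m′) _ ⟨
  Σ< (suc m′) (λ j → A (k * j + r) * A (k * (suc m′ ∸ j) ∸ r ∸ 1)) ∎
  where
  k : ℕ
  k = suc k′
  A : ℕ → ℕ
  A = a k
  -- Since k and m are successors, suc N reduces to k * m.
  N s : ℕ
  N = k * suc m′ ∸ 1
  s = k′ ∸ r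
  open Residues k
  r+s≡k′ : r + s ≡ k′
  r+s≡k′ = m+[n∸m]≡n (s≤s⁻¹ r<k)
  r+s<k : r + s < k
  r+s<k = s≤s (≤-reflexive r+s≡k′)
  N%k≡r+s : N % k ≡ r + s
  N%k≡r+s = trans (cong (_% k) (k*[1+t]∸r∸1≡k*t+[k∸[1+r]] k m′ z<s)) (trans ([k*q+t]%k≡t m′ ≤-refl) (sym r+s≡k′))
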